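{- Define power series $\sigma^0(t)=t$, $\sigma^1(t)=e^t-1$, $\sigma^p(t)=\sigma^{p-1}(e^t-1)$ for $p>1$, and the higher order Bell polynomials $B^p_n(x)$ ($p\ge0$) by $\sum_{n\ge0}B^p_n(x)\frac{t^n}{n!}=e^{x\sigma^p(t)}$. Then for every $p\ge1$ and $n\ge0$, \[B^p_n(x)=\frac{1}{e^x}\sum_{k=0}^\infty\frac{x^kB^{p-1}_n(k)}{k!}.\]
   Context: In particular $B^0_n(x)=x^n$, so the case $p=1$ is Dobiński's formula for the Bell polynomials. -}

module Defs where

open import Data.Nat as ℕ using (ℕ; zero; suc; _∸_; _!)
open import Data.Nat.Properties using (_!≢0)
open import Data.Integer as ℤ using (ℤ; +_)
open import Data.Rational using (ℚ; 0ℚ; 1ℚ; _+_; _*_; -_; _/_)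

sumTo : ℕ → (ℕ → ℚ) → ℚ
sumTo zero    f = f 0
sumTo (suc n) f = sumTo n f + f (suc n)

_^_ : ℚ → ℕ → ℚ
x ^ zero  = 1ℚ
x ^ suc k = x * (x ^ k)

invFact : ℕ → ℚ
invFact k = (+ 1 / (k !)) {{k !≢0}}

FPS : Set
FPS = ℕ → ℚ

_⊛_ : FPS → FPS → FPS
(f ⊛ g) n = sumTo n (λ i → f i * g (n ∸ i))

oneS : FPS
oneS zero    = 1ℚ
oneS (suc _) = 0ℚ

tS : FPS
tS 1 = 1ℚ
tS _ = 0ℚ

powS : FPS → ℕ → FPS
powS f zero    = oneS
powS f (suc j) = f ⊛ powS f j

-- composition f(g(t)), for g with zero constant term
_∘S_ : FPS → FPS → FPS
(f ∘S g) n = sumTo n (λ j → f j * powS g j n)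

expm1 : FPS
expm1 zero    = 0ℚ
expm1 (suc k) = invFact (suc k)

σ : ℕ → FPS
σ zero    = tS
σ (suc p) = σ p ∘S expm1

-- Higher order Bell polynomial B^p_n(x), as its coefficient sequence in x:
-- e^{x σ^p(t)} = Σ_j x^j σ^p(t)^j / j!, so the coefficient of x^j t^n/n!
-- in e^{x σ^p(t)} is  n! / j! · [t^n] σ^p(t)^j .
BellCoeff : ℕ → ℕ → ℕ → ℚ
BellCoeff p n j = (((+ (n !)) / 1) * invFact j) * powS (σ p) j n

-- evaluation of B^p_n at x (a polynomial of degree ≤ n, since σ^p(0)=0)
Bell : ℕ → ℕ → ℚ → ℚ
Bell p n x = sumTo n (λ j → BellCoeff p n j * (x ^ j))

expNegS : FPS
expNegS k = ((- 1ℚ) ^ k) * invFact k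

-- Σ_k x^k B^{q}_n(k) / k!  as a formal power series in x
dobinskiS : ℕ → ℕ → FPS
dobinskiS q n k = Bell q n ((+ k) / 1) * invFact k

{-# OPTIONS --safe #-}
-- Let E(t) = eᵗ − 1. Since σᵖ = E ∘ σᵖ⁻¹, it suffices to show, for any series g with g(0) = 0,
-- that e^(x E(g(t))) = e^(−x) Σₖ xᵏ e^(k g(t)) / k!. Comparing coefficients of xᵐ, this is
-- Eᵐ/m! = Σ_{i+k=m} (−1)ⁱ/i! · e^(kt)/k! composed with g, which is the binomial theorem for
-- (eᵗ − 1)ᵐ together with e^(at) e^(bt) = e^((a+b)t). Taking n! [tⁿ] of e^(k g(t)) = Σⱼ kʲ gʲ/j!
-- gives the Bell polynomial of g evaluated at k.
module Submission where

open import Defs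
open import Data.Nat.Base as ℕ using (ℕ; zero; suc; _∸_; _!; _≤_; _<_; z≤n; s≤s)
import Data.Nat.Properties as ℕₚ
open import Data.Nat.Combinatorics using (_C_; nCk+nC[k+1]≡[n+1]C[k+1]; k![n∸k]!∣n!)
open import Data.Nat.Combinatorics.Specification using (nCk≡n!/k![n-k]!; k>n⇒nCk≡0)
open import Data.Nat.Coprimality as Coprimality using (1-coprimeTo)
open import Data.Nat.DivMod using (m/n*n≡m)
import Data.Integer.Base as ℤ
import Data.Integer.Properties as ℤₚ
open import Data.Rational.Base using (ℚ; 0ℚ; 1ℚ; _+_; _*_; -_; _/_; mkℚ)
open import Data.Rational.Properties
open import Data.Rational.Solver using (module +-*-Solver)
open import Data.Empty using (⊥-elim)
open import Data.Sum.Base using (inj₁; inj₂)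
open import Relation.Binary.PropositionalEquality
open import Relation.Nullary.Negation using (¬_)

open +-*-Solver using (solve; _:+_; _:*_; :-_; _:=_; con)
open ≡-Reasoning

fromℕ : ℕ → ℚ
fromℕ n = ℤ.+ n / 1

fromℕ≡mkℚ : ∀ n → fromℕ n ≡ mkℚ (ℤ.+ n) 0 (Coprimality.sym (1-coprimeTo n))
fromℕ≡mkℚ n = normalize-coprime (Coprimality.sym (1-coprimeTo n))

fromℕ-+ : ∀ a b → fromℕ (a ℕ.+ b) ≡ fromℕ a + fromℕ b
fromℕ-+ a b rewrite fromℕ≡mkℚ a | fromℕ≡mkℚ b = sym (/-cong {p₂ = ℤ.+ (a ℕ.+ b)} {q₂ = 1}
  (trans (cong₂ ℤ._+_ (ℤₚ.*-identityʳ (ℤ.+ a)) (ℤₚ.*-identityʳ (ℤ.+ b))) (sym (ℤₚ.pos-+ a b))) refl)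

fromℕ-* : ∀ a b → fromℕ (a ℕ.* b) ≡ fromℕ a * fromℕ b
fromℕ-* a b rewrite fromℕ≡mkℚ a | fromℕ≡mkℚ b =
  sym (/-cong {p₂ = ℤ.+ (a ℕ.* b)} {q₂ = 1} (sym (ℤₚ.pos-* a b)) refl)

1/-*-fromℕ : ∀ d .{{_ : ℕ.NonZero d}} → (ℤ.+ 1 / d) * fromℕ d ≡ 1ℚ
1/-*-fromℕ (suc d) rewrite fromℕ≡mkℚ (suc d) | normalize-coprime {1} {d} (1-coprimeTo (suc d)) =
  *-inverseˡ (mkℚ (ℤ.+ suc d) 0 (Coprimality.sym (1-coprimeTo (suc d))))

invFact-*-fromℕ! : ∀ k → invFact k * fromℕ (k !) ≡ 1ℚ
invFact-*-fromℕ! k = 1/-*-fromℕ (k !) {{k ℕₚ.!≢0}}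

sumTo-cong≤ : ∀ n {f g : ℕ → ℚ} → (∀ i → i ≤ n → f i ≡ g i) → sumTo n f ≡ sumTo n g
sumTo-cong≤ zero    f≡g = f≡g 0 z≤n
sumTo-cong≤ (suc n) f≡g =
  cong₂ _+_ (sumTo-cong≤ n (λ i i≤n → f≡g i (ℕₚ.m≤n⇒m≤1+n i≤n))) (f≡g (suc n) ℕₚ.≤-refl)

sumTo-cong : ∀ n {f g : ℕ → ℚ} → (∀ i → f i ≡ g i) → sumTo n f ≡ sumTo n g
sumTo-cong n f≡g = sumTo-cong≤ n (λ i _ → f≡g i)

sumTo-zero : ∀ n {f : ℕ → ℚ} → (∀ i → i ≤ n → f i ≡ 0ℚ) → sumTo n f ≡ 0ℚ
sumTo-zero zero    f≡0 = f≡0 0 z≤n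
sumTo-zero (suc n) f≡0 =
  cong₂ _+_ (sumTo-zero n (λ i i≤n → f≡0 i (ℕₚ.m≤n⇒m≤1+n i≤n))) (f≡0 (suc n) ℕₚ.≤-refl)

sumTo-distrib-+ : ∀ n (f g : ℕ → ℚ) → sumTo n (λ i → f i + g i) ≡ sumTo n f + sumTo n g
sumTo-distrib-+ zero    f g = refl
sumTo-distrib-+ (suc n) f g = begin
  sumTo n (λ i → f i + g i) + (f (suc n) + g (suc n))
    ≡⟨ cong (_+ (f (suc n) + g (suc n))) (sumTo-distrib-+ n f g) ⟩
  (sumTo n f + sumTo n g) + (f (suc n) + g (suc n))
    ≡⟨ solve 4 (λ a b c d → (a :+ b) :+ (c :+ d) := (a :+ c) :+ (b :+ d)) refl
         (sumTo n f) (sumTo n g) (f (suc n)) (g (suc n)) ⟩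
  sumTo (suc n) f + sumTo (suc n) g ∎

*-distribˡ-sumTo : ∀ n c (f : ℕ → ℚ) → c * sumTo n f ≡ sumTo n (λ i → c * f i)
*-distribˡ-sumTo zero    c f = refl
*-distribˡ-sumTo (suc n) c f = trans (*-distribˡ-+ c (sumTo n f) (f (suc n)))
  (cong (_+ c * f (suc n)) (*-distribˡ-sumTo n c f))

*-distribʳ-sumTo : ∀ n c (f : ℕ → ℚ) → sumTo n f * c ≡ sumTo n (λ i → f i * c)
*-distribʳ-sumTo zero    c f = refl
*-distribʳ-sumTo (suc n) c f = trans (*-distribʳ-+ c (sumTo n f) (f (suc n)))
  (cong (_+ f (suc n) * c) (*-distribʳ-sumTo n c f))

neg-distrib-sumTo : ∀ n (f : ℕ → ℚ) → - sumTo n f ≡ sumTo n (λ i → - f i)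
neg-distrib-sumTo zero    f = refl
neg-distrib-sumTo (suc n) f = trans (neg-distrib-+ (sumTo n f) (f (suc n)))
  (cong (_+ - f (suc n)) (neg-distrib-sumTo n f))

sumTo-suc : ∀ n (f : ℕ → ℚ) → sumTo (suc n) f ≡ f 0 + sumTo n (λ i → f (suc i))
sumTo-suc zero    f = refl
sumTo-suc (suc n) f = trans (cong (_+ f (suc (suc n))) (sumTo-suc n f))
  (+-assoc (f 0) (sumTo n (λ i → f (suc i))) (f (suc (suc n))))

sumTo-extend : ∀ n m (f : ℕ → ℚ) → n ≤ m → (∀ i → n < i → f i ≡ 0ℚ) → sumTo m f ≡ sumTo n f
sumTo-extend n m f n≤m f≡0 = begin
  sumTo m f               ≡⟨ cong (λ k → sumTo k f) (sym (ℕₚ.m∸n+n≡m n≤m)) ⟩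
  sumTo (m ∸ n ℕ.+ n) f   ≡⟨ extend (m ∸ n) ⟩
  sumTo n f               ∎
  where
  extend : ∀ k → sumTo (k ℕ.+ n) f ≡ sumTo n f
  extend zero    = refl
  extend (suc k) = trans (cong₂ _+_ (extend k) (f≡0 (suc (k ℕ.+ n)) (s≤s (ℕₚ.m≤n+m n k))))
    (+-identityʳ (sumTo n f))

sumTo-swap : ∀ n m (f : ℕ → ℕ → ℚ) →
  sumTo n (λ i → sumTo m (f i)) ≡ sumTo m (λ j → sumTo n (λ i → f i j))
sumTo-swap zero    m f = refl
sumTo-swap (suc n) m f = trans (cong (_+ sumTo m (f (suc n))) (sumTo-swap n m f))
  (sym (sumTo-distrib-+ m (λ j → sumTo n (λ i → f i j)) (f (suc n))))

sumTo-reverse : ∀ n (f : ℕ → ℚ) → sumTo n f ≡ sumTo n (λ i → f (n ∸ i))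
sumTo-reverse zero    f = refl
sumTo-reverse (suc n) f = begin
  sumTo n f + f (suc n)                 ≡⟨ cong (_+ f (suc n)) (sumTo-reverse n f) ⟩
  sumTo n (λ i → f (n ∸ i)) + f (suc n) ≡⟨ +-comm (sumTo n (λ i → f (n ∸ i))) (f (suc n)) ⟩
  f (suc n) + sumTo n (λ i → f (n ∸ i)) ≡⟨ sym (sumTo-suc n (λ i → f (suc n ∸ i))) ⟩
  sumTo (suc n) (λ i → f (suc n ∸ i))   ∎

sumTo-single : ∀ n k (f : ℕ → ℚ) → k ≤ n → (∀ i → ¬ i ≡ k → f i ≡ 0ℚ) → sumTo n f ≡ f k
sumTo-single zero    .zero f z≤n  f≡0 = refl
sumTo-single (suc n) k     f k≤1+n f≡0 with ℕₚ.m≤n⇒m<n∨m≡n k≤1+n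
... | inj₁ k<1+n = begin
  sumTo n f + f (suc n) ≡⟨ cong₂ _+_ (sumTo-single n k f (ℕₚ.≤-pred k<1+n) f≡0)
                                     (f≡0 (suc n) (λ e → ℕₚ.<⇒≢ k<1+n (sym e))) ⟩
  f k + 0ℚ              ≡⟨ +-identityʳ (f k) ⟩
  f k                   ∎
... | inj₂ refl = begin
  sumTo n f + f (suc n) ≡⟨ cong (_+ f (suc n)) (sumTo-zero n (λ i i≤n → f≡0 i (λ { refl → ℕₚ.1+n≰n i≤n }))) ⟩
  0ℚ + f (suc n)        ≡⟨ +-identityˡ (f (suc n)) ⟩
  f (suc n)             ∎

sumTo-antidiagonal : ∀ n (F : ℕ → ℕ → ℚ) →
  sumTo n (λ k → sumTo k (λ i → F i (k ∸ i))) ≡ sumTo n (λ i → sumTo (n ∸ i) (F i))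
sumTo-antidiagonal zero    F = refl
sumTo-antidiagonal (suc n) F = begin
  sumTo n (λ k → sumTo k (λ i → F i (k ∸ i))) + (sumTo n (λ i → F i (suc n ∸ i)) + F (suc n) (n ∸ n))
    ≡⟨ cong₂ (λ a b → a + (sumTo n (λ i → F i (suc n ∸ i)) + F (suc n) b))
             (sumTo-antidiagonal n F) (ℕₚ.n∸n≡0 n) ⟩
  A + (B + F (suc n) 0)
    ≡⟨ sym (+-assoc A B (F (suc n) 0)) ⟩
  (A + B) + F (suc n) 0
    ≡⟨ cong (_+ F (suc n) 0) (sym (sumTo-distrib-+ n _ _)) ⟩
  sumTo n (λ i → sumTo (n ∸ i) (F i) + F i (suc n ∸ i)) + F (suc n) 0
    ≡⟨ cong₂ _+_ (sumTo-cong≤ n row) (cong (λ k → sumTo k (F (suc n))) (sym (ℕₚ.n∸n≡0 n))) ⟩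
  sumTo (suc n) (λ i → sumTo (suc n ∸ i) (F i)) ∎
  where
  A = sumTo n (λ i → sumTo (n ∸ i) (F i))
  B = sumTo n (λ i → F i (suc n ∸ i))
  row : ∀ i → i ≤ n → sumTo (n ∸ i) (F i) + F i (suc n ∸ i) ≡ sumTo (suc n ∸ i) (F i)
  row i i≤n rewrite ℕₚ.+-∸-assoc 1 i≤n = refl

⊛-cong : ∀ {f f′ g g′ : FPS} → (∀ k → f k ≡ f′ k) → (∀ k → g k ≡ g′ k) → ∀ n → (f ⊛ g) n ≡ (f′ ⊛ g′) n
⊛-cong f≡f′ g≡g′ n = sumTo-cong n (λ i → cong₂ _*_ (f≡f′ i) (g≡g′ (n ∸ i)))

⊛-comm : ∀ (f g : FPS) n → (f ⊛ g) n ≡ (g ⊛ f) n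
⊛-comm f g n = begin
  sumTo n (λ i → f i * g (n ∸ i))             ≡⟨ sumTo-reverse n (λ i → f i * g (n ∸ i)) ⟩
  sumTo n (λ i → f (n ∸ i) * g (n ∸ (n ∸ i))) ≡⟨ sumTo-cong≤ n swap ⟩
  sumTo n (λ i → g i * f (n ∸ i))             ∎
  where
  swap : ∀ i → i ≤ n → f (n ∸ i) * g (n ∸ (n ∸ i)) ≡ g i * f (n ∸ i)
  swap i i≤n rewrite ℕₚ.m∸[m∸n]≡n i≤n = *-comm (f (n ∸ i)) (g i)

⊛-assoc : ∀ (f g h : FPS) n → ((f ⊛ g) ⊛ h) n ≡ (f ⊛ (g ⊛ h)) n
⊛-assoc f g h n = begin
  sumTo n (λ k → sumTo k (λ i → f i * g (k ∸ i)) * h (n ∸ k))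
    ≡⟨ sumTo-cong n (λ k → trans (*-distribʳ-sumTo k (h (n ∸ k)) _) (sumTo-cong≤ k (reassoc k))) ⟩
  sumTo n (λ k → sumTo k (λ i → F i (k ∸ i)))
    ≡⟨ sumTo-antidiagonal n F ⟩
  sumTo n (λ i → sumTo (n ∸ i) (F i))
    ≡⟨ sumTo-cong n (λ i → sym (*-distribˡ-sumTo (n ∸ i) (f i) (λ j → g j * h (n ∸ i ∸ j)))) ⟩
  sumTo n (λ i → f i * sumTo (n ∸ i) (λ j → g j * h (n ∸ i ∸ j))) ∎
  where
  F : ℕ → ℕ → ℚ
  F i j = f i * (g j * h (n ∸ i ∸ j))
  reassoc : ∀ k i → i ≤ k → (f i * g (k ∸ i)) * h (n ∸ k) ≡ F i (k ∸ i)
  reassoc k i i≤k rewrite ℕₚ.∸-+-assoc n i (k ∸ i) | ℕₚ.m+[n∸m]≡n i≤k =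
    *-assoc (f i) (g (k ∸ i)) (h (n ∸ k))

⊛-distribʳ-+ : ∀ (f g h : FPS) n → ((λ k → f k + g k) ⊛ h) n ≡ (f ⊛ h) n + (g ⊛ h) n
⊛-distribʳ-+ f g h n = trans (sumTo-cong n (λ i → *-distribʳ-+ (h (n ∸ i)) (f i) (g i))) (sumTo-distrib-+ n _ _)

neg-distribˡ-⊛ : ∀ (f h : FPS) n → ((λ k → - f k) ⊛ h) n ≡ - (f ⊛ h) n
neg-distribˡ-⊛ f h n = trans (sumTo-cong n (λ i → sym (neg-distribˡ-* (f i) (h (n ∸ i)))))
  (sym (neg-distrib-sumTo n _))

⊛-*ʳ : ∀ (f g : FPS) c n → (f ⊛ (λ k → c * g k)) n ≡ c * (f ⊛ g) n
⊛-*ʳ f g c n = trans (sumTo-cong n (λ i → swap (f i) (g (n ∸ i)))) (sym (*-distribˡ-sumTo n c _))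
  where
  swap : ∀ a b → a * (c * b) ≡ c * (a * b)
  swap a b = solve 3 (λ a b c → a :* (c :* b) := c :* (a :* b)) refl a b c

⊛-distribˡ-sumTo : ∀ (f : FPS) m (G : ℕ → FPS) n →
  (f ⊛ (λ k → sumTo m (λ i → G i k))) n ≡ sumTo m (λ i → (f ⊛ G i) n)
⊛-distribˡ-sumTo f m G n = trans (sumTo-cong n (λ l → *-distribˡ-sumTo m (f l) (λ i → G i (n ∸ l))))
  (sumTo-swap n m (λ l i → f l * G i (n ∸ l)))

⊛-identityˡ : ∀ (f : FPS) n → (oneS ⊛ f) n ≡ f n
⊛-identityˡ f zero    = *-identityˡ (f 0)
⊛-identityˡ f (suc n) = begin
  sumTo (suc n) (λ i → oneS i * f (suc n ∸ i))
    ≡⟨ sumTo-suc n _ ⟩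
  1ℚ * f (suc n) + sumTo n (λ i → 0ℚ * f (n ∸ i))
    ≡⟨ cong₂ _+_ (*-identityˡ (f (suc n))) (sumTo-zero n (λ i _ → *-zeroˡ (f (n ∸ i)))) ⟩
  f (suc n) + 0ℚ
    ≡⟨ +-identityʳ (f (suc n)) ⟩
  f (suc n) ∎

⊛-identityʳ : ∀ (f : FPS) n → (f ⊛ oneS) n ≡ f n
⊛-identityʳ f n = trans (⊛-comm f oneS n) (⊛-identityˡ f n)

powS-cong : ∀ {f g : FPS} → (∀ k → f k ≡ g k) → ∀ j n → powS f j n ≡ powS g j n
powS-cong f≡g zero    n = refl
powS-cong f≡g (suc j) n = ⊛-cong f≡g (powS-cong f≡g j) n

powS-+ : ∀ (f : FPS) a b n → powS f (a ℕ.+ b) n ≡ (powS f a ⊛ powS f b) n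
powS-+ f zero    b n = sym (⊛-identityˡ (powS f b) n)
powS-+ f (suc a) b n = trans (⊛-cong {f} (λ _ → refl) (powS-+ f a b) n)
  (sym (⊛-assoc f (powS f a) (powS f b) n))

powS-< : ∀ (f : FPS) → f 0 ≡ 0ℚ → ∀ j n → n < j → powS f j n ≡ 0ℚ
powS-< f f0≡0 (suc j) n n<1+j = sumTo-zero n term
  where
  term : ∀ i → i ≤ n → f i * powS f j (n ∸ i) ≡ 0ℚ
  term zero    _   = trans (cong (_* powS f j n) f0≡0) (*-zeroˡ (powS f j n))
  term (suc i) i<n = trans (cong (f (suc i) *_) (powS-< f f0≡0 j (n ∸ suc i) n∸1+i<j))
    (*-zeroʳ (f (suc i)))
    where
    n∸1+i<j : n ∸ suc i < j
    n∸1+i<j = ℕₚ.<-≤-trans (ℕₚ.∸-monoʳ-< {n} {suc i} {0} (s≤s z≤n) i<n) (ℕₚ.≤-pred n<1+j)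

∘S-congˡ : ∀ {f f′ : FPS} (g : FPS) → (∀ k → f k ≡ f′ k) → ∀ n → (f ∘S g) n ≡ (f′ ∘S g) n
∘S-congˡ g f≡f′ n = sumTo-cong n (λ j → cong (_* powS g j n) (f≡f′ j))

∘S-constant : ∀ (f g : FPS) → (f ∘S g) 0 ≡ f 0
∘S-constant f g = *-identityʳ (f 0)

∘S-extend : ∀ (f h : FPS) → h 0 ≡ 0ℚ → ∀ n m → n ≤ m → (f ∘S h) n ≡ sumTo m (λ j → f j * powS h j n)
∘S-extend f h h0≡0 n m n≤m = sym (sumTo-extend n m _ n≤m
  (λ j n<j → trans (cong (f j *_) (powS-< h h0≡0 j n n<j)) (*-zeroʳ (f j))))

oneS-∘S : ∀ (h : FPS) n → (oneS ∘S h) n ≡ oneS n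
oneS-∘S h zero    = refl
oneS-∘S h (suc n) = begin
  sumTo (suc n) (λ j → oneS j * powS h j (suc n))
    ≡⟨ sumTo-suc n _ ⟩
  1ℚ * 0ℚ + sumTo n (λ j → 0ℚ * powS h (suc j) (suc n))
    ≡⟨ cong (1ℚ * 0ℚ +_) (sumTo-zero n (λ j _ → *-zeroˡ (powS h (suc j) (suc n)))) ⟩
  0ℚ ∎

-- Both sides equal Σ_{k,r ≤ n} a_k b_r [tⁿ] h^(k+r).
∘S-distrib-⊛ : ∀ (a b h : FPS) → h 0 ≡ 0ℚ → ∀ n → ((a ⊛ b) ∘S h) n ≡ ((a ∘S h) ⊛ (b ∘S h)) n
∘S-distrib-⊛ a b h h0≡0 n = trans lhs (sym rhs)
  where
  F : ℕ → ℕ → ℚ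
  F k r = a k * (b r * powS h (k ℕ.+ r) n)
  T : ℚ
  T = sumTo n (λ k → sumTo n (F k))
  lhs : ((a ⊛ b) ∘S h) n ≡ T
  lhs = begin
    sumTo n (λ j → sumTo j (λ k → a k * b (j ∸ k)) * powS h j n)
      ≡⟨ sumTo-cong n (λ j → trans (*-distribʳ-sumTo j _ _) (sumTo-cong≤ j (reassoc j))) ⟩
    sumTo n (λ j → sumTo j (λ k → F k (j ∸ k)))
      ≡⟨ sumTo-antidiagonal n F ⟩
    sumTo n (λ k → sumTo (n ∸ k) (F k))
      ≡⟨ sumTo-cong≤ n (λ k k≤n → sym (sumTo-extend (n ∸ k) n (F k) (ℕₚ.m∸n≤m n k) (F≡0 k k≤n))) ⟩
    T ∎
    where
    reassoc : ∀ j k → k ≤ j → (a k * b (j ∸ k)) * powS h j n ≡ F k (j ∸ k)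
    reassoc j k k≤j rewrite ℕₚ.m+[n∸m]≡n k≤j = *-assoc (a k) (b (j ∸ k)) (powS h j n)
    F≡0 : ∀ k → k ≤ n → ∀ r → n ∸ k < r → F k r ≡ 0ℚ
    F≡0 k k≤n r n∸k<r = begin
      a k * (b r * powS h (k ℕ.+ r) n) ≡⟨ cong (λ x → a k * (b r * x)) (powS-< h h0≡0 (k ℕ.+ r) n n<k+r) ⟩
      a k * (b r * 0ℚ)                 ≡⟨ cong (a k *_) (*-zeroʳ (b r)) ⟩
      a k * 0ℚ                         ≡⟨ *-zeroʳ (a k) ⟩
      0ℚ                               ∎
      where
      n<k+r : n < k ℕ.+ r
      n<k+r = subst (_< k ℕ.+ r) (ℕₚ.m+[n∸m]≡n k≤n) (ℕₚ.+-monoʳ-< k n∸k<r)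
  rhs : ((a ∘S h) ⊛ (b ∘S h)) n ≡ T
  rhs = begin
    sumTo n (λ l → (a ∘S h) l * (b ∘S h) (n ∸ l))
      ≡⟨ sumTo-cong≤ n (λ l l≤n → cong₂ _*_ (∘S-extend a h h0≡0 l n l≤n)
                                             (∘S-extend b h h0≡0 (n ∸ l) n (ℕₚ.m∸n≤m n l))) ⟩
    sumTo n (λ l → sumTo n (λ k → a k * powS h k l) * sumTo n (λ r → b r * powS h r (n ∸ l)))
      ≡⟨ sumTo-cong n (λ l → trans (*-distribʳ-sumTo n _ _) (sumTo-cong n (λ k → *-distribˡ-sumTo n (a k * powS h k l) _))) ⟩
    sumTo n (λ l → sumTo n (λ k → sumTo n (λ r → G k r l)))
      ≡⟨ trans (sumTo-swap n n _) (sumTo-cong n (λ k → sumTo-swap n n (λ l r → G k r l))) ⟩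
    sumTo n (λ k → sumTo n (λ r → sumTo n (G k r)))
      ≡⟨ sumTo-cong n (λ k → sumTo-cong n (λ r → collect k r)) ⟩
    T ∎
    where
    G : ℕ → ℕ → ℕ → ℚ
    G k r l = (a k * powS h k l) * (b r * powS h r (n ∸ l))
    collect : ∀ k r → sumTo n (G k r) ≡ F k r
    collect k r = begin
      sumTo n (G k r)
        ≡⟨ sumTo-cong n (λ l → solve 4 (λ x y u v → (x :* u) :* (y :* v) := (x :* y) :* (u :* v)) refl
                                 (a k) (b r) (powS h k l) (powS h r (n ∸ l))) ⟩
      sumTo n (λ l → (a k * b r) * (powS h k l * powS h r (n ∸ l)))
        ≡⟨ sym (*-distribˡ-sumTo n (a k * b r) _) ⟩
      (a k * b r) * (powS h k ⊛ powS h r) n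
        ≡⟨ cong ((a k * b r) *_) (sym (powS-+ h k r n)) ⟩
      (a k * b r) * powS h (k ℕ.+ r) n
        ≡⟨ *-assoc (a k) (b r) (powS h (k ℕ.+ r) n) ⟩
      F k r ∎

powS-∘S : ∀ (f h : FPS) → h 0 ≡ 0ℚ → ∀ m n → powS (f ∘S h) m n ≡ (powS f m ∘S h) n
powS-∘S f h h0≡0 zero    n = sym (oneS-∘S h n)
powS-∘S f h h0≡0 (suc m) n = trans (⊛-cong {f ∘S h} (λ _ → refl) (powS-∘S f h h0≡0 m) n)
  (sym (∘S-distrib-⊛ f (powS f m) h h0≡0 n))

∘S-assoc : ∀ (f g h : FPS) → g 0 ≡ 0ℚ → h 0 ≡ 0ℚ → ∀ n → ((f ∘S g) ∘S h) n ≡ (f ∘S (g ∘S h)) n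
∘S-assoc f g h g0≡0 h0≡0 n = begin
  sumTo n (λ j → (f ∘S g) j * powS h j n)
    ≡⟨ sumTo-cong≤ n (λ j j≤n → cong (_* powS h j n) (∘S-extend f g g0≡0 j n j≤n)) ⟩
  sumTo n (λ j → sumTo n (λ i → f i * powS g i j) * powS h j n)
    ≡⟨ sumTo-cong n (λ j → trans (*-distribʳ-sumTo n _ _) (sumTo-cong n (λ i → *-assoc (f i) _ _))) ⟩
  sumTo n (λ j → sumTo n (λ i → f i * (powS g i j * powS h j n)))
    ≡⟨ sumTo-swap n n _ ⟩
  sumTo n (λ i → sumTo n (λ j → f i * (powS g i j * powS h j n)))
    ≡⟨ sumTo-cong n (λ i → sym (*-distribˡ-sumTo n (f i) _)) ⟩
  sumTo n (λ i → f i * (powS g i ∘S h) n)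
    ≡⟨ sumTo-cong n (λ i → cong (f i *_) (sym (powS-∘S g h h0≡0 i n))) ⟩
  sumTo n (λ i → f i * powS (g ∘S h) i n) ∎

tS-≢1 : ∀ i → ¬ i ≡ 1 → tS i ≡ 0ℚ
tS-≢1 zero          _   = refl
tS-≢1 (suc zero)    i≢1 = ⊥-elim (i≢1 refl)
tS-≢1 (suc (suc i)) _   = refl

sumTo-tS : ∀ n (f : ℕ → ℚ) → sumTo (suc n) (λ i → tS i * f i) ≡ f 1
sumTo-tS n f = trans (sumTo-single (suc n) 1 _ (s≤s z≤n)
  (λ i i≢1 → trans (cong (_* f i) (tS-≢1 i i≢1)) (*-zeroˡ (f i)))) (*-identityˡ (f 1))

tS-⊛ : ∀ (g : FPS) n → (tS ⊛ g) (suc n) ≡ g n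
tS-⊛ g n = sumTo-tS n (λ i → g (suc n ∸ i))

powS-tS-≡ : ∀ j → powS tS j j ≡ 1ℚ
powS-tS-≡ zero    = refl
powS-tS-≡ (suc j) = trans (tS-⊛ (powS tS j) j) (powS-tS-≡ j)

powS-tS-≢ : ∀ j n → ¬ j ≡ n → powS tS j n ≡ 0ℚ
powS-tS-≢ zero    zero    j≢n = ⊥-elim (j≢n refl)
powS-tS-≢ zero    (suc n) j≢n = refl
powS-tS-≢ (suc j) zero    j≢n = *-zeroˡ (powS tS j 0)
powS-tS-≢ (suc j) (suc n) j≢n = trans (tS-⊛ (powS tS j) n) (powS-tS-≢ j n (λ j≡n → j≢n (cong suc j≡n)))

∘S-identityʳ : ∀ (f : FPS) n → (f ∘S tS) n ≡ f n
∘S-identityʳ f n = begin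
  sumTo n (λ j → f j * powS tS j n) ≡⟨ sumTo-single n n _ ℕₚ.≤-refl off-diagonal ⟩
  f n * powS tS n n                 ≡⟨ cong (f n *_) (powS-tS-≡ n) ⟩
  f n * 1ℚ                          ≡⟨ *-identityʳ (f n) ⟩
  f n                               ∎
  where
  off-diagonal : ∀ j → ¬ j ≡ n → f j * powS tS j n ≡ 0ℚ
  off-diagonal j j≢n = trans (cong (f j *_) (powS-tS-≢ j n j≢n)) (*-zeroʳ (f j))

∘S-identityˡ : ∀ (f : FPS) → f 0 ≡ 0ℚ → ∀ n → (tS ∘S f) n ≡ f n
∘S-identityˡ f f0≡0 zero    = trans (*-zeroˡ 1ℚ) (sym f0≡0)
∘S-identityˡ f f0≡0 (suc n) = trans (sumTo-tS n (λ j → powS f j (suc n))) (⊛-identityʳ f (suc n))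

σ-constant : ∀ p → σ p 0 ≡ 0ℚ
σ-constant zero    = refl
σ-constant (suc p) = trans (∘S-constant (σ p) expm1) (σ-constant p)

-- σ^p is the p-fold iterate of e^t − 1, so it commutes with e^t − 1 under composition.
σ-∘S-expm1-comm : ∀ p n → (σ p ∘S expm1) n ≡ (expm1 ∘S σ p) n
σ-∘S-expm1-comm zero    n = trans (∘S-identityˡ expm1 refl n) (sym (∘S-identityʳ expm1 n))
σ-∘S-expm1-comm (suc p) n = trans (∘S-congˡ expm1 (σ-∘S-expm1-comm p) n)
  (∘S-assoc expm1 (σ p) expm1 (σ-constant p) refl n)

nCk*[k!*[n∸k]!]≡n! : ∀ {n k} → k ≤ n → (n C k) ℕ.* (k ! ℕ.* (n ∸ k) !) ≡ n !
nCk*[k!*[n∸k]!]≡n! {n} {k} k≤n = trans (cong (ℕ._* (k ! ℕ.* (n ∸ k) !)) (nCk≡n!/k![n-k]! k≤n))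
  (m/n*n≡m {{k !* (n ∸ k) !≢0}} (k![n∸k]!∣n! k≤n))
  where open ℕₚ using (_!*_!≢0)

invFact-*-invFact : ∀ {n k} → k ≤ n → invFact k * invFact (n ∸ k) ≡ invFact n * fromℕ (n C k)
invFact-*-invFact {n} {k} k≤n = begin
  a * b                         ≡⟨ sym (*-identityʳ (a * b)) ⟩
  (a * b) * 1ℚ                  ≡⟨ cong ((a * b) *_) (sym (invFact-*-fromℕ! n)) ⟩
  (a * b) * (c * fromℕ (n !))   ≡⟨ cong (λ z → (a * b) * (c * z)) (sym factorials) ⟩
  (a * b) * (c * (d * (u * v))) ≡⟨ solve 6 (λ a b c d u v → (a :* b) :* (c :* (d :* (u :* v)))
                                        := (c :* d) :* ((a :* u) :* (b :* v))) refl a b c d u v ⟩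
  (c * d) * ((a * u) * (b * v)) ≡⟨ cong₂ (λ x y → (c * d) * (x * y)) (invFact-*-fromℕ! k) (invFact-*-fromℕ! (n ∸ k)) ⟩
  (c * d) * (1ℚ * 1ℚ)           ≡⟨ *-identityʳ (c * d) ⟩
  c * d                         ∎
  where
  a = invFact k
  b = invFact (n ∸ k)
  c = invFact n
  d = fromℕ (n C k)
  u = fromℕ (k !)
  v = fromℕ ((n ∸ k) !)
  factorials : d * (u * v) ≡ fromℕ (n !)
  factorials = begin
    d * (u * v)                           ≡⟨ cong (d *_) (sym (fromℕ-* (k !) ((n ∸ k) !))) ⟩
    d * fromℕ (k ! ℕ.* (n ∸ k) !)         ≡⟨ sym (fromℕ-* (n C k) _) ⟩
    fromℕ ((n C k) ℕ.* (k ! ℕ.* (n ∸ k) !)) ≡⟨ cong fromℕ (nCk*[k!*[n∸k]!]≡n! k≤n) ⟩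
    fromℕ (n !)                           ∎

sumTo-pascal : ∀ j (u : ℕ → ℚ) →
  sumTo (suc j) (λ l → fromℕ (suc j C l) * u l)
    ≡ sumTo j (λ l → fromℕ (j C l) * u l) + sumTo j (λ l → fromℕ (j C l) * u (suc l))
sumTo-pascal j u = begin
  sumTo (suc j) (λ l → fromℕ (suc j C l) * u l)
    ≡⟨ sumTo-suc j _ ⟩
  u₀ + sumTo j (λ l → fromℕ (suc j C suc l) * u (suc l))
    ≡⟨ cong (u₀ +_) (trans (sumTo-cong j split) (sumTo-distrib-+ j _ _)) ⟩
  u₀ + (A + B)
    ≡⟨ solve 3 (λ u₀ A B → u₀ :+ (A :+ B) := (u₀ :+ B) :+ A) refl u₀ A B ⟩
  (u₀ + B) + A
    ≡⟨ cong (_+ A) (sym (sumTo-suc j (λ l → fromℕ (j C l) * u l))) ⟩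
  sumTo (suc j) (λ l → fromℕ (j C l) * u l) + A
    ≡⟨ cong (_+ A) (sumTo-extend j (suc j) _ (ℕₚ.n≤1+n j) beyond) ⟩
  sumTo j (λ l → fromℕ (j C l) * u l) + A ∎
  where
  u₀ = fromℕ 1 * u 0
  A = sumTo j (λ l → fromℕ (j C l) * u (suc l))
  B = sumTo j (λ l → fromℕ (j C suc l) * u (suc l))
  split : ∀ l → fromℕ (suc j C suc l) * u (suc l) ≡ fromℕ (j C l) * u (suc l) + fromℕ (j C suc l) * u (suc l)
  split l rewrite sym (nCk+nC[k+1]≡[n+1]C[k+1] j l) | fromℕ-+ (j C l) (j C suc l) =
    *-distribʳ-+ (u (suc l)) (fromℕ (j C l)) (fromℕ (j C suc l))
  beyond : ∀ l → j < l → fromℕ (j C l) * u l ≡ 0ℚ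
  beyond l j<l rewrite k>n⇒nCk≡0 j<l = *-zeroˡ (u l)

binomial : ∀ x y j → sumTo j (λ l → fromℕ (j C l) * (x ^ l * y ^ (j ∸ l))) ≡ (x + y) ^ j
binomial x y zero    = refl
binomial x y (suc j) = begin
  sumTo (suc j) (λ l → fromℕ (suc j C l) * (x ^ l * y ^ (suc j ∸ l)))
    ≡⟨ sumTo-pascal j (λ l → x ^ l * y ^ (suc j ∸ l)) ⟩
  sumTo j (λ l → fromℕ (j C l) * (x ^ l * y ^ (suc j ∸ l))) + sumTo j (λ l → fromℕ (j C l) * (x ^ suc l * y ^ (j ∸ l)))
    ≡⟨ cong₂ _+_ (sumTo-cong≤ j y-factor) (sumTo-cong j x-factor) ⟩
  sumTo j (λ l → y * T l) + sumTo j (λ l → x * T l)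
    ≡⟨ sym (cong₂ _+_ (*-distribˡ-sumTo j y T) (*-distribˡ-sumTo j x T)) ⟩
  y * S + x * S
    ≡⟨ trans (+-comm (y * S) (x * S)) (sym (*-distribʳ-+ S x y)) ⟩
  (x + y) * S
    ≡⟨ cong ((x + y) *_) (binomial x y j) ⟩
  (x + y) ^ suc j ∎
  where
  T : ℕ → ℚ
  T l = fromℕ (j C l) * (x ^ l * y ^ (j ∸ l))
  S = sumTo j T
  y-factor : ∀ l → l ≤ j → fromℕ (j C l) * (x ^ l * y ^ (suc j ∸ l)) ≡ y * T l
  y-factor l l≤j rewrite ℕₚ.+-∸-assoc 1 l≤j =
    solve 4 (λ c a b y → c :* (a :* (y :* b)) := y :* (c :* (a :* b))) refl (fromℕ (j C l)) (x ^ l) (y ^ (j ∸ l)) y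
  x-factor : ∀ l → fromℕ (j C l) * (x ^ suc l * y ^ (j ∸ l)) ≡ x * T l
  x-factor l = solve 4 (λ c a b x → c :* ((x :* a) :* b) := x :* (c :* (a :* b))) refl (fromℕ (j C l)) (x ^ l) (y ^ (j ∸ l)) x

expS : ℕ → FPS
expS a j = fromℕ a ^ j * invFact j

expS-+ : ∀ a b j → (expS a ⊛ expS b) j ≡ expS (a ℕ.+ b) j
expS-+ a b j = begin
  sumTo j (λ l → (A ^ l * invFact l) * (B ^ (j ∸ l) * invFact (j ∸ l)))
    ≡⟨ sumTo-cong≤ j term ⟩
  sumTo j (λ l → (fromℕ (j C l) * (A ^ l * B ^ (j ∸ l))) * invFact j)
    ≡⟨ sym (*-distribʳ-sumTo j (invFact j) _) ⟩
  sumTo j (λ l → fromℕ (j C l) * (A ^ l * B ^ (j ∸ l))) * invFact j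
    ≡⟨ cong (_* invFact j) (trans (binomial A B j) (cong (_^ j) (sym (fromℕ-+ a b)))) ⟩
  expS (a ℕ.+ b) j ∎
  where
  A = fromℕ a
  B = fromℕ b
  term : ∀ l → l ≤ j →
    (A ^ l * invFact l) * (B ^ (j ∸ l) * invFact (j ∸ l)) ≡ (fromℕ (j C l) * (A ^ l * B ^ (j ∸ l))) * invFact j
  term l l≤j = begin
    (A ^ l * invFact l) * (B ^ (j ∸ l) * invFact (j ∸ l))
      ≡⟨ solve 4 (λ x y p q → (x :* p) :* (y :* q) := (x :* y) :* (p :* q)) refl
           (A ^ l) (B ^ (j ∸ l)) (invFact l) (invFact (j ∸ l)) ⟩
    (A ^ l * B ^ (j ∸ l)) * (invFact l * invFact (j ∸ l))
      ≡⟨ cong ((A ^ l * B ^ (j ∸ l)) *_) (invFact-*-invFact l≤j) ⟩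
    (A ^ l * B ^ (j ∸ l)) * (invFact j * fromℕ (j C l))
      ≡⟨ solve 3 (λ z f c → z :* (f :* c) := (c :* z) :* f) refl
           (A ^ l * B ^ (j ∸ l)) (invFact j) (fromℕ (j C l)) ⟩
    (fromℕ (j C l) * (A ^ l * B ^ (j ∸ l))) * invFact j ∎

1^n≡1 : ∀ n → 1ℚ ^ n ≡ 1ℚ
1^n≡1 zero    = refl
1^n≡1 (suc n) = trans (*-identityˡ (1ℚ ^ n)) (1^n≡1 n)

expm1≡expS1-oneS : ∀ k → expm1 k ≡ expS 1 k + - oneS k
expm1≡expS1-oneS zero    = refl
expm1≡expS1-oneS (suc k) = sym (begin
  (1ℚ * 1ℚ ^ k) * invFact (suc k) + 0ℚ ≡⟨ +-identityʳ _ ⟩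
  (1ℚ * 1ℚ ^ k) * invFact (suc k)      ≡⟨ cong (_* invFact (suc k)) (1^n≡1 (suc k)) ⟩
  1ℚ * invFact (suc k)                 ≡⟨ *-identityˡ (invFact (suc k)) ⟩
  invFact (suc k)                      ∎)

powS-expm1 : ∀ m j → powS expm1 m j ≡ sumTo m (λ i → fromℕ (m C i) * ((- 1ℚ) ^ i * expS (m ∸ i) j))
powS-expm1 zero    zero    = refl
powS-expm1 zero    (suc j) = sym (begin
  fromℕ 1 * (1ℚ * ((0ℚ * 0ℚ ^ j) * invFact (suc j))) ≡⟨ trans (*-identityˡ _) (*-identityˡ _) ⟩
  (0ℚ * 0ℚ ^ j) * invFact (suc j)                   ≡⟨ cong (_* invFact (suc j)) (*-zeroˡ (0ℚ ^ j)) ⟩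
  0ℚ * invFact (suc j)                              ≡⟨ *-zeroˡ (invFact (suc j)) ⟩
  0ℚ                                                ∎)
powS-expm1 (suc m) j = begin
  (expm1 ⊛ powS expm1 m) j
    ≡⟨ ⊛-cong expm1≡expS1-oneS (powS-expm1 m) j ⟩
  ((λ k → expS 1 k + - oneS k) ⊛ X) j
    ≡⟨ ⊛-distribʳ-+ (expS 1) (λ k → - oneS k) X j ⟩
  (expS 1 ⊛ X) j + ((λ k → - oneS k) ⊛ X) j
    ≡⟨ cong₂ _+_ shifted (trans (neg-distribˡ-⊛ oneS X j) (cong -_ (⊛-identityˡ X j))) ⟩
  sumTo m (λ i → fromℕ (m C i) * u i) + - X j
    ≡⟨ cong (sumTo m (λ i → fromℕ (m C i) * u i) +_) negated ⟩
  sumTo m (λ i → fromℕ (m C i) * u i) + sumTo m (λ i → fromℕ (m C i) * u (suc i))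
    ≡⟨ sym (sumTo-pascal m u) ⟩
  sumTo (suc m) (λ i → fromℕ (suc m C i) * u i) ∎
  where
  X : FPS
  X k = sumTo m (λ i → fromℕ (m C i) * ((- 1ℚ) ^ i * expS (m ∸ i) k))
  u : ℕ → ℚ
  u i = (- 1ℚ) ^ i * expS (suc m ∸ i) j
  shifted : (expS 1 ⊛ X) j ≡ sumTo m (λ i → fromℕ (m C i) * u i)
  shifted = begin
    (expS 1 ⊛ X) j
      ≡⟨ ⊛-distribˡ-sumTo (expS 1) m (λ i k → fromℕ (m C i) * ((- 1ℚ) ^ i * expS (m ∸ i) k)) j ⟩
    sumTo m (λ i → (expS 1 ⊛ (λ k → fromℕ (m C i) * ((- 1ℚ) ^ i * expS (m ∸ i) k))) j)
      ≡⟨ sumTo-cong m (λ i → trans (⊛-*ʳ (expS 1) (λ k → (- 1ℚ) ^ i * expS (m ∸ i) k) (fromℕ (m C i)) j)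
                                (cong (fromℕ (m C i) *_) (⊛-*ʳ (expS 1) (expS (m ∸ i)) ((- 1ℚ) ^ i) j))) ⟩
    sumTo m (λ i → fromℕ (m C i) * ((- 1ℚ) ^ i * (expS 1 ⊛ expS (m ∸ i)) j))
      ≡⟨ sumTo-cong≤ m (λ i i≤m → cong (λ z → fromℕ (m C i) * ((- 1ℚ) ^ i * z))
                                   (trans (expS-+ 1 (m ∸ i) j) (cong (λ a → expS a j) (sym (ℕₚ.+-∸-assoc 1 i≤m))))) ⟩
    sumTo m (λ i → fromℕ (m C i) * u i) ∎
  negated : - X j ≡ sumTo m (λ i → fromℕ (m C i) * u (suc i))
  negated = trans (neg-distrib-sumTo m _) (sumTo-cong m (λ i →
    solve 3 (λ c s e → :- (c :* (s :* e)) := c :* ((con (- 1ℚ) :* s) :* e)) refl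
      (fromℕ (m C i)) ((- 1ℚ) ^ i) (expS (m ∸ i) j)))

invFact-*-powS-expm1 : ∀ m j → invFact m * powS expm1 m j ≡ (expNegS ⊛ (λ k → invFact k * expS k j)) m
invFact-*-powS-expm1 m j = begin
  invFact m * powS expm1 m j
    ≡⟨ cong (invFact m *_) (powS-expm1 m j) ⟩
  invFact m * sumTo m (λ i → fromℕ (m C i) * ((- 1ℚ) ^ i * expS (m ∸ i) j))
    ≡⟨ *-distribˡ-sumTo m (invFact m) _ ⟩
  sumTo m (λ i → invFact m * (fromℕ (m C i) * ((- 1ℚ) ^ i * expS (m ∸ i) j)))
    ≡⟨ sumTo-cong≤ m term ⟩
  sumTo m (λ i → expNegS i * (invFact (m ∸ i) * expS (m ∸ i) j)) ∎
  where
  term : ∀ i → i ≤ m → invFact m * (fromℕ (m C i) * ((- 1ℚ) ^ i * expS (m ∸ i) j))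
                      ≡ expNegS i * (invFact (m ∸ i) * expS (m ∸ i) j)
  term i i≤m = begin
    invFact m * (fromℕ (m C i) * (s * e))   ≡⟨ sym (*-assoc (invFact m) (fromℕ (m C i)) (s * e)) ⟩
    (invFact m * fromℕ (m C i)) * (s * e)   ≡⟨ cong (_* (s * e)) (sym (invFact-*-invFact i≤m)) ⟩
    (invFact i * invFact (m ∸ i)) * (s * e) ≡⟨ solve 4 (λ a b s e → (a :* b) :* (s :* e) := (s :* a) :* (b :* e)) refl
                                                 (invFact i) (invFact (m ∸ i)) s e ⟩
    (s * invFact i) * (invFact (m ∸ i) * e) ∎
    where
    s = (- 1ℚ) ^ i
    e = expS (m ∸ i) j

-- Bell polynomials of an arbitrary series g: e^(x g(t)) = Σₙ Bₙ(x) tⁿ/n!.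
-- BellCoeff p and Bell p are BellCoeffOf (σ p) and BellOf (σ p) by definition.
BellCoeffOf : FPS → ℕ → ℕ → ℚ
BellCoeffOf g n j = (fromℕ (n !) * invFact j) * powS g j n

BellOf : FPS → ℕ → ℚ → ℚ
BellOf g n x = sumTo n (λ j → BellCoeffOf g n j * x ^ j)

dobinski : ∀ g → g 0 ≡ 0ℚ → ∀ n m →
  BellCoeffOf (expm1 ∘S g) n m ≡ (expNegS ⊛ (λ k → BellOf g n (fromℕ k) * invFact k)) m
dobinski g g0≡0 n m = begin
  (N * invFact m) * powS (expm1 ∘S g) m n
    ≡⟨ cong ((N * invFact m) *_) (powS-∘S expm1 g g0≡0 m n) ⟩
  (N * invFact m) * sumTo n (λ j → powS expm1 m j * P j)
    ≡⟨ trans (*-distribˡ-sumTo n (N * invFact m) (λ j → powS expm1 m j * P j)) (sumTo-cong n (λ j → regroup (powS expm1 m j) (P j))) ⟩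
  sumTo n (λ j → (invFact m * powS expm1 m j) * (N * P j))
    ≡⟨ sumTo-cong n (λ j → cong (_* (N * P j)) (invFact-*-powS-expm1 m j)) ⟩
  sumTo n (λ j → (expNegS ⊛ (λ k → invFact k * expS k j)) m * (N * P j))
    ≡⟨ sumTo-cong n (λ j → *-distribʳ-sumTo m (N * P j) _) ⟩
  sumTo n (λ j → sumTo m (λ i → (expNegS i * (invFact (m ∸ i) * expS (m ∸ i) j)) * (N * P j)))
    ≡⟨ sumTo-swap n m _ ⟩
  sumTo m (λ i → sumTo n (λ j → (expNegS i * (invFact (m ∸ i) * expS (m ∸ i) j)) * (N * P j)))
    ≡⟨ sumTo-cong m (λ i → column (expNegS i) (m ∸ i)) ⟩
  sumTo m (λ i → expNegS i * (BellOf g n (fromℕ (m ∸ i)) * invFact (m ∸ i))) ∎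
  where
  N = fromℕ (n !)
  P : ℕ → ℚ
  P j = powS g j n
  regroup : ∀ e p → (N * invFact m) * (e * p) ≡ (invFact m * e) * (N * p)
  regroup e p = solve 4 (λ N f e p → (N :* f) :* (e :* p) := (f :* e) :* (N :* p)) refl N (invFact m) e p
  column : ∀ c k → sumTo n (λ j → (c * (invFact k * expS k j)) * (N * P j)) ≡ c * (BellOf g n (fromℕ k) * invFact k)
  column c k = begin
    sumTo n (λ j → (c * (invFact k * expS k j)) * (N * P j))
      ≡⟨ sumTo-cong n (λ j → solve 6 (λ c f x J N p → (c :* (f :* (x :* J))) :* (N :* p)
                                         := c :* ((((N :* J) :* p) :* x) :* f)) refl
                               c (invFact k) (fromℕ k ^ j) (invFact j) N (P j)) ⟩
    sumTo n (λ j → c * ((BellCoeffOf g n j * fromℕ k ^ j) * invFact k))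
      ≡⟨ sym (*-distribˡ-sumTo n c _) ⟩
    c * sumTo n (λ j → (BellCoeffOf g n j * fromℕ k ^ j) * invFact k)
      ≡⟨ cong (c *_) (sym (*-distribʳ-sumTo n (invFact k) _)) ⟩
    c * (BellOf g n (fromℕ k) * invFact k) ∎

proposition4 : (p n : ℕ) → 1 ≤ p →
    ∀ m → BellCoeff p n m ≡ (expNegS ⊛ dobinskiS (p ∸ 1) n) m
proposition4 (suc q) n _ m = begin
  BellCoeffOf (σ q ∘S expm1) n m
    ≡⟨ cong ((fromℕ (n !) * invFact m) *_) (powS-cong (σ-∘S-expm1-comm q) m n) ⟩
  BellCoeffOf (expm1 ∘S σ q) n m
    ≡⟨ dobinski (σ q) (σ-constant q) n m ⟩
  (expNegS ⊛ dobinskiS q n) m ∎
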